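{- Define the integer sequence $(x_k)_{k \ge 0}$ by $x_0 = 11427$, $x_1 = 2984191388685$ and $x_{k+2} = 261152656\, x_{k+1} - x_k$ for $k \ge 0$. Then for every fixed squarefree integer $m \ge 648560$ there are infinitely many $k \in \mathbb{N}$ such that $$\left\{\frac{x_k}{m^{3/2}}\right\} > \frac{2}{m^{3/2}}.$$
   Context: For a real number $\xi$, $\{\xi\}$ denotes its fractional part. -}

module Defs where

open import Data.Nat as ℕ using (ℕ; zero; suc; _^_)
open import Data.Nat.Divisibility using (_∣_)
open import Data.Integer as ℤ using (ℤ; +_; -[1+_])
open import Data.Empty using (⊥)
open import Data.Unit using (⊤)
open import Relation.Binary.PropositionalEquality using (_≡_)

x : ℕ → ℤ
x zero = + 11427
x (suc zero) = + 2984191388685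
x (suc (suc k)) = (+ 261152656) ℤ.* x (suc k) ℤ.- x k

SquareFree : ℕ → Set
SquareFree m = ∀ (d : ℕ) → d ℕ.* d ∣ m → d ≡ 1

-- Exact comparisons of the real number q · m^{3/2} = q · √(m³) with an integer z,
-- for q z : ℤ, m : ℕ, decided by squaring (no reals in the library).
-- LeS q m z  ⟺  q · m^{3/2} ≤ z
LeS : ℤ → ℕ → ℤ → Set
LeS (+ n) m (+ k) = n ℕ.* n ℕ.* (m ^ 3) ℕ.≤ k ℕ.* k
LeS (+ n) m -[1+ k ] = ⊥
LeS -[1+ n ] m (+ k) = ⊤
LeS -[1+ n ] m -[1+ k ] = suc k ℕ.* suc k ℕ.≤ suc n ℕ.* suc n ℕ.* (m ^ 3)

-- LtS q m z  ⟺  q · m^{3/2} < z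
LtS : ℤ → ℕ → ℤ → Set
LtS (+ n) m (+ k) = n ℕ.* n ℕ.* (m ^ 3) ℕ.< k ℕ.* k
LtS (+ n) m -[1+ k ] = ⊥
LtS -[1+ n ] m (+ k) = ⊤
LtS -[1+ n ] m -[1+ k ] = suc k ℕ.* suc k ℕ.< suc n ℕ.* suc n ℕ.* (m ^ 3)

-- FracGt z m  ⟺  { z / m^{3/2} } > 2 / m^{3/2}   (for m ≥ 1).
-- With r = m^{3/2} > 0 and y = z / r:  {y} > 2/r  ⟺  z - ⌊y⌋ r > 2
-- ⟺ every integer q with q r ≤ z satisfies q r < z - 2.
FracGt : ℤ → ℕ → Set
FracGt z m = ∀ (q : ℤ) → LeS q m z → LtS q m (z ℤ.- + 2)

-- Write M = m³, c = 261152656 and q k = ⌊x k / √M⌋. If {x k / √M} ≤ 2 / √M for all k in a long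
-- window, then α k = x k − q k √M lies in [0, 2] there. The integer q (k+2) − c q (k+1) + q k is
-- −(α (k+2) − c α (k+1) + α k) / √M, which is too small to be nonzero because √M > 2c + 1, so α
-- satisfies the recurrence of x as well. A nonnegative solution grows like (c − 1)^k away from its
-- minimum, so a bounded one is tiny in the middle of the window, and hence so is its invariant
-- α (k+1)² − c α k α (k+1) + α k² = I + MJ − b√M. Here I = −34100354867927166 is the invariant of
-- x, and J, b are integers. Multiplying by the conjugate I + MJ + b√M, which is bounded, shows that
-- the integer (I + MJ)² − Mb² vanishes. As m is squarefree, √M is irrational, so I + MJ = 0 and M
-- divides 34100354867927166 < M, a contradiction. To stay within the integers, √M is replaced by a
-- rational approximation p / s with s large and α k by E k = s x k − p q k.

{-# OPTIONS --safe #-}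
module Submission where

open import Defs
open import Data.Nat using (ℕ; _≤_)
open import Data.Product using (Σ; _×_)

open import Data.Nat
  using (zero; suc; _+_; _*_; _∸_; _^_; _<_; _≤?_; _<?_; _≤′_; ≤′-refl; ≤′-step; z≤n; s≤s; s≤s⁻¹; z<s;
         NonZero; ≢-nonZero; >-nonZero; anyUpTo?)
open import Data.Nat.Properties
open import Data.Nat.Coprimality using (coprime-/gcd; coprime-divisor)
import Data.Nat.Coprimality as Coprime
open import Data.Nat.Divisibility using (_∣_; divides; ∣-refl; ∣⇒≤)
open import Data.Nat.DivMod using (_/_; m/n*n≡m)
open import Data.Nat.GCD using (gcd; gcd[m,n]∣m; gcd[m,n]∣n; gcd[m,n]≡0⇒m≡0)
import Data.Nat.Tactic.RingSolver as ℕ-Ring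
open import Data.Integer as ℤ using (ℤ; +_; -[1+_]; ∣_∣)
import Data.Integer.Properties as ℤP
import Data.Integer.Tactic.RingSolver as ℤ-Ring
open import Data.Product using (_,_; proj₁; proj₂; ∃-syntax; map₂)
open import Data.Sum using (inj₁; inj₂)
open import Data.Empty using (⊥; ⊥-elim)
open import Data.Unit using (tt)
open import Function using (case_of_)
open import Relation.Nullary using (¬_; yes; no)
open import Relation.Unary using (Decidable)
open import Relation.Binary.PropositionalEquality
  using (_≡_; _≢_; refl; sym; trans; cong; cong₂; subst; module ≡-Reasoning)

m*m≤n*n⇒m≤n : ∀ {m n} → m * m ≤ n * n → m ≤ n
m*m≤n*n⇒m≤n h = ≮⇒≥ (λ n<m → <⇒≱ (*-mono-< n<m n<m) h)

n<m^n : ∀ {m} → 2 ≤ m → ∀ n → n < m ^ n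
n<m^n 2≤m zero = z<s
n<m^n {m} 2≤m (suc n) = begin-strict
  suc n          ≤⟨ n<m^n 2≤m n ⟩
  m ^ n          <⟨ m<m+n (m ^ n) (≤-<-trans z≤n (n<m^n 2≤m n)) ⟩
  m ^ n + m ^ n  ≡⟨ cong (λ t → m ^ n + t) (sym (+-identityʳ (m ^ n))) ⟩
  2 * m ^ n      ≤⟨ *-monoˡ-≤ (m ^ n) 2≤m ⟩
  m ^ suc n      ∎
  where open ≤-Reasoning

[m*n]*[m*n]≡m*m*[n*n] : ∀ m n → (m * n) * (m * n) ≡ m * m * (n * n)
[m*n]*[m*n]≡m*m*[n*n] = ℕ-Ring.solve-∀

quotient-≤ : ∀ {p a b m n} → b < p → a + p * m ≡ b + p * n → m ≤ n
quotient-≤ {p} {a} {b} {m} {n} b<p eq = ≮⇒≥ λ n<m → <-irrefl refl (begin-strict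
  b + p * n      <⟨ +-monoˡ-< (p * n) b<p ⟩
  p + p * n      ≡⟨ sym (*-suc p n) ⟩
  p * suc n      ≤⟨ *-monoʳ-≤ p n<m ⟩
  p * m          ≤⟨ m≤n+m (p * m) a ⟩
  a + p * m      ≡⟨ eq ⟩
  b + p * n      ∎)
  where open ≤-Reasoning

quotient-unique : ∀ {p a b m n} → a < p → b < p → a + p * m ≡ b + p * n → m ≡ n
quotient-unique a<p b<p eq = ≤-antisym (quotient-≤ b<p eq) (quotient-≤ a<p (sym eq))

ascending⇒monotone : ∀ (f : ℕ → ℕ) → (∀ i → f i ≤ f (suc i)) → ∀ {i j} → i ≤ j → f i ≤ f j
ascending⇒monotone f ascending i≤j = go (≤⇒≤′ i≤j)
  where
  go : ∀ {i j} → i ≤′ j → f i ≤ f j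
  go ≤′-refl        = ≤-refl
  go (≤′-step i≤′j) = ≤-trans (go i≤′j) (ascending _)

≤-half-sum : ∀ {a t r n} → a ≤ t + r → 2 * t ≤ n → 2 * r < n → a < n
≤-half-sum {a} {t} {r} {n} a≤t+r 2t≤n 2r<n = *-cancelˡ-< 2 a n (begin-strict
  2 * a          ≤⟨ *-monoʳ-≤ 2 a≤t+r ⟩
  2 * (t + r)    ≡⟨ *-distribˡ-+ 2 t r ⟩
  2 * t + 2 * r  <⟨ +-mono-≤-< 2t≤n 2r<n ⟩
  n + n          ≡⟨ cong (λ k → n + k) (sym (+-identityʳ n)) ⟩
  2 * n          ∎)
  where open ≤-Reasoning

≤-double : ∀ {u p a B} → u ≤ p + p → p * a ≤ B → u * a ≤ 2 * B
≤-double {u} {p} {a} {B} u≤2p pa≤B = begin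
  u * a          ≤⟨ *-monoˡ-≤ a u≤2p ⟩
  (p + p) * a    ≡⟨ *-distribʳ-+ a p p ⟩
  p * a + p * a  ≤⟨ +-mono-≤ pa≤B pa≤B ⟩
  B + B          ≡⟨ cong (λ k → B + k) (sym (+-identityʳ B)) ⟩
  2 * B          ∎
  where open ≤-Reasoning

-- Integer square roots

last-before : ∀ {ℓ} {P : ℕ → Set ℓ} → Decidable P → P 0 → ∀ n → ¬ P n → ∃[ k ] P k × ¬ P (suc k)
last-before P? P0 zero ¬P0 = ⊥-elim (¬P0 P0)
last-before P? P0 (suc n) ¬Pn+1 with P? n
... | yes Pn = n , Pn , ¬Pn+1
... | no ¬Pn = last-before P? P0 n ¬Pn

floor-root : ∀ M T .{{_ : NonZero M}} → ∃[ q ] q * q * M ≤ T × T < suc q * suc q * M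
floor-root M T = map₂ (map₂ ≰⇒>) (last-before (λ q → q * q * M ≤? T) z≤n (suc T) (<⇒≱ T<))
  where
  T< : T < suc T * suc T * M
  T< = ≤-trans (m≤m*n (suc T) (suc T)) (m≤m*n (suc T * suc T) M)

fracGt-of-floor : ∀ m X q → X * X < suc q * suc q * m ^ 3 → q * q * m ^ 3 < (X ∸ 2) * (X ∸ 2) →
                  FracGt (+ X) m
fracGt-of-floor m (suc (suc w)) q X<⌈X⌉ gap (+ n) n≤X =
  ≤-<-trans (*-monoˡ-≤ (m ^ 3) (*-mono-≤ n≤q n≤q)) gap
  where
  n≤q : n ≤ q
  n≤q = ≮⇒≥ (λ q<n → <⇒≱ X<⌈X⌉ (≤-trans (*-monoˡ-≤ (m ^ 3) (*-mono-≤ q<n q<n)) n≤X))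
fracGt-of-floor m (suc (suc w)) q _ _ -[1+ n ] _ = tt

-- Squarefree numbers

NotRatioOfSquares : ℕ → Set
NotRatioOfSquares M = ∀ a b → a * a ≡ M * (b * b) → a ≡ 0

squarefree⇒notRatioOfSquares : ∀ {m} → SquareFree m → 2 ≤ m → NotRatioOfSquares m
squarefree⇒notRatioOfSquares sf 2≤m zero b eq = refl
squarefree⇒notRatioOfSquares {m} sf 2≤m a@(suc _) b eq =
  ⊥-elim (<⇒≢ 2≤m (trans (cong (λ t → t * t) (sym a′≡1)) a′²≡m))
  where
  g a′ b′ : ℕ
  g = gcd a b
  instance
    g≢0 : NonZero g
    g≢0 = ≢-nonZero (λ g≡0 → 1+n≢0 (gcd[m,n]≡0⇒m≡0 {n = b} g≡0))
  a′ = a / g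
  b′ = b / g
  a′²≡m*b′² : a′ * a′ ≡ m * (b′ * b′)
  a′²≡m*b′² = *-cancelʳ-≡ _ _ (g * g) {{m*n≢0 g g}} (begin
    a′ * a′ * (g * g)       ≡⟨ sym ([m*n]*[m*n]≡m*m*[n*n] a′ g) ⟩
    (a′ * g) * (a′ * g)     ≡⟨ cong (λ t → t * t) (m/n*n≡m (gcd[m,n]∣m a b)) ⟩
    a * a                   ≡⟨ eq ⟩
    m * (b * b)             ≡⟨ cong (λ t → m * (t * t)) (sym (m/n*n≡m (gcd[m,n]∣n a b))) ⟩
    m * ((b′ * g) * (b′ * g)) ≡⟨ cong (m *_) ([m*n]*[m*n]≡m*m*[n*n] b′ g) ⟩
    m * (b′ * b′ * (g * g)) ≡⟨ sym (*-assoc m (b′ * b′) (g * g)) ⟩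
    m * (b′ * b′) * (g * g) ∎)
    where open ≡-Reasoning
  b′∣a′ : b′ ∣ a′
  b′∣a′ = coprime-divisor (Coprime.sym (coprime-/gcd a b))
            (divides (m * b′) (trans a′²≡m*b′² (sym (*-assoc m b′ b′))))
  a′²≡m : a′ * a′ ≡ m
  a′²≡m = trans a′²≡m*b′² (trans (cong (λ t → m * (t * t)) (coprime-/gcd a b (b′∣a′ , ∣-refl))) (*-identityʳ m))
  a′≡1 : a′ ≡ 1
  a′≡1 = sf a′ (divides 1 (sym (trans (*-identityˡ (a′ * a′)) a′²≡m)))

cube-notRatioOfSquares : ∀ {m} → NotRatioOfSquares m → NotRatioOfSquares (m ^ 3)
cube-notRatioOfSquares {m} irr a b eq = irr a (m * b) (trans eq (m³b²≡m[mb]² m b))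
  where
  m³b²≡m[mb]² : ∀ m b → m * (m * (m * 1)) * (b * b) ≡ m * ((m * b) * (m * b))
  m³b²≡m[mb]² = ℕ-Ring.solve-∀

∣i-j+k∣≤∣i∣+∣j∣+∣k∣ : ∀ i j k → ∣ i ℤ.- j ℤ.+ k ∣ ≤ ∣ i ∣ + ∣ j ∣ + ∣ k ∣
∣i-j+k∣≤∣i∣+∣j∣+∣k∣ i j k =
  ≤-trans (ℤP.∣i+j∣≤∣i∣+∣j∣ (i ℤ.- j) k) (+-monoˡ-≤ ∣ k ∣ (ℤP.∣i-j∣≤∣i∣+∣j∣ i j))

∣i+j+k-l∣≤∣i∣+[∣j∣+∣k∣+∣l∣] : ∀ i j k l → ∣ i ℤ.+ j ℤ.+ k ℤ.- l ∣ ≤ ∣ i ∣ + (∣ j ∣ + ∣ k ∣ + ∣ l ∣)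
∣i+j+k-l∣≤∣i∣+[∣j∣+∣k∣+∣l∣] i j k l = begin
  ∣ i ℤ.+ j ℤ.+ k ℤ.- l ∣           ≤⟨ ℤP.∣i-j∣≤∣i∣+∣j∣ (i ℤ.+ j ℤ.+ k) l ⟩
  ∣ i ℤ.+ j ℤ.+ k ∣ + ∣ l ∣         ≤⟨ +-monoˡ-≤ ∣ l ∣ (ℤP.∣i+j∣≤∣i∣+∣j∣ (i ℤ.+ j) k) ⟩
  ∣ i ℤ.+ j ∣ + ∣ k ∣ + ∣ l ∣       ≤⟨ +-monoˡ-≤ ∣ l ∣ (+-monoˡ-≤ ∣ k ∣ (ℤP.∣i+j∣≤∣i∣+∣j∣ i j)) ⟩
  ∣ i ∣ + ∣ j ∣ + ∣ k ∣ + ∣ l ∣     ≡⟨ rearrange (∣ i ∣) (∣ j ∣) (∣ k ∣) (∣ l ∣) ⟩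
  ∣ i ∣ + (∣ j ∣ + ∣ k ∣ + ∣ l ∣)   ∎
  where
  open ≤-Reasoning
  rearrange : ∀ a b c d → a + b + c + d ≡ a + (b + c + d)
  rearrange = ℕ-Ring.solve-∀

∣i*j*k∣≡∣i∣*∣j∣*∣k∣ : ∀ i j k → ∣ i ℤ.* j ℤ.* k ∣ ≡ ∣ i ∣ * ∣ j ∣ * ∣ k ∣
∣i*j*k∣≡∣i∣*∣j∣*∣k∣ i j k = trans (ℤP.abs-* (i ℤ.* j) k) (cong (_* ∣ k ∣) (ℤP.abs-* i j))

pos-∸ : ∀ {m n} → n ≤ m → + (m ∸ n) ≡ + m ℤ.- + n
pos-∸ {m} {n} n≤m = sym (trans (ℤP.m-n≡m⊖n m n) (ℤP.⊖-≥ n≤m))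

-- The invariant form of the recurrence

form : ℤ → ℤ → ℤ → ℤ
form C a b = b ℤ.* b ℤ.- C ℤ.* a ℤ.* b ℤ.+ a ℤ.* a

polar : ℤ → ℤ → ℤ → ℤ → ℤ → ℤ
polar C x₀ x₁ y₀ y₁ = + 2 ℤ.* x₁ ℤ.* y₁ ℤ.- C ℤ.* (x₀ ℤ.* y₁ ℤ.+ x₁ ℤ.* y₀) ℤ.+ + 2 ℤ.* x₀ ℤ.* y₀

-- The ring solver does not unfold form or polar, so each identity is proved in expanded form.
form-step : ∀ C a b → form C b (C ℤ.* b ℤ.- a) ≡ form C a b
form-step = expanded
  where
  expanded : ∀ C a b → (C ℤ.* b ℤ.- a) ℤ.* (C ℤ.* b ℤ.- a) ℤ.- C ℤ.* b ℤ.* (C ℤ.* b ℤ.- a) ℤ.+ b ℤ.* b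
                     ≡ b ℤ.* b ℤ.- C ℤ.* a ℤ.* b ℤ.+ a ℤ.* a
  expanded = ℤ-Ring.solve-∀

form-of-difference : ∀ C s p x₀ x₁ y₀ y₁ →
  form C (s ℤ.* x₀ ℤ.- p ℤ.* y₀) (s ℤ.* x₁ ℤ.- p ℤ.* y₁)
    ≡ (s ℤ.* s ℤ.* form C x₀ x₁ ℤ.+ p ℤ.* p ℤ.* form C y₀ y₁) ℤ.- s ℤ.* p ℤ.* polar C x₀ x₁ y₀ y₁
form-of-difference = expanded
  where
  expanded : ∀ C s p x₀ x₁ y₀ y₁ →
    (s ℤ.* x₁ ℤ.- p ℤ.* y₁) ℤ.* (s ℤ.* x₁ ℤ.- p ℤ.* y₁)
      ℤ.- C ℤ.* (s ℤ.* x₀ ℤ.- p ℤ.* y₀) ℤ.* (s ℤ.* x₁ ℤ.- p ℤ.* y₁)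
      ℤ.+ (s ℤ.* x₀ ℤ.- p ℤ.* y₀) ℤ.* (s ℤ.* x₀ ℤ.- p ℤ.* y₀)
    ≡ (s ℤ.* s ℤ.* (x₁ ℤ.* x₁ ℤ.- C ℤ.* x₀ ℤ.* x₁ ℤ.+ x₀ ℤ.* x₀)
        ℤ.+ p ℤ.* p ℤ.* (y₁ ℤ.* y₁ ℤ.- C ℤ.* y₀ ℤ.* y₁ ℤ.+ y₀ ℤ.* y₀))
      ℤ.- s ℤ.* p ℤ.* (+ 2 ℤ.* x₁ ℤ.* y₁ ℤ.- C ℤ.* (x₀ ℤ.* y₁ ℤ.+ x₁ ℤ.* y₀) ℤ.+ + 2 ℤ.* x₀ ℤ.* y₀)
  expanded = ℤ-Ring.solve-∀

form-of-sum : ∀ C s p x₀ x₁ y₀ y₁ →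
  form C (s ℤ.* x₀ ℤ.+ p ℤ.* y₀) (s ℤ.* x₁ ℤ.+ p ℤ.* y₁)
    ≡ (s ℤ.* s ℤ.* form C x₀ x₁ ℤ.+ p ℤ.* p ℤ.* form C y₀ y₁) ℤ.+ s ℤ.* p ℤ.* polar C x₀ x₁ y₀ y₁
form-of-sum = expanded
  where
  expanded : ∀ C s p x₀ x₁ y₀ y₁ →
    (s ℤ.* x₁ ℤ.+ p ℤ.* y₁) ℤ.* (s ℤ.* x₁ ℤ.+ p ℤ.* y₁)
      ℤ.- C ℤ.* (s ℤ.* x₀ ℤ.+ p ℤ.* y₀) ℤ.* (s ℤ.* x₁ ℤ.+ p ℤ.* y₁)
      ℤ.+ (s ℤ.* x₀ ℤ.+ p ℤ.* y₀) ℤ.* (s ℤ.* x₀ ℤ.+ p ℤ.* y₀)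
    ≡ (s ℤ.* s ℤ.* (x₁ ℤ.* x₁ ℤ.- C ℤ.* x₀ ℤ.* x₁ ℤ.+ x₀ ℤ.* x₀)
        ℤ.+ p ℤ.* p ℤ.* (y₁ ℤ.* y₁ ℤ.- C ℤ.* y₀ ℤ.* y₁ ℤ.+ y₀ ℤ.* y₀))
      ℤ.+ s ℤ.* p ℤ.* (+ 2 ℤ.* x₁ ℤ.* y₁ ℤ.- C ℤ.* (x₀ ℤ.* y₁ ℤ.+ x₁ ℤ.* y₀) ℤ.+ + 2 ℤ.* x₀ ℤ.* y₀)
  expanded = ℤ-Ring.solve-∀

2*form≡polar : ∀ C a b → + 2 ℤ.* form C a b ≡ polar C a b a b
2*form≡polar = expanded
  where
  expanded : ∀ C a b → + 2 ℤ.* (b ℤ.* b ℤ.- C ℤ.* a ℤ.* b ℤ.+ a ℤ.* a)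
                       ≡ + 2 ℤ.* b ℤ.* b ℤ.- C ℤ.* (a ℤ.* b ℤ.+ b ℤ.* a) ℤ.+ + 2 ℤ.* a ℤ.* a
  expanded = ℤ-Ring.solve-∀

polar⁺ : ℕ → ℕ → ℕ → ℕ → ℕ → ℕ
polar⁺ c x₀ x₁ y₀ y₁ = 2 * x₁ * y₁ + c * (x₀ * y₁ + x₁ * y₀) + 2 * x₀ * y₀

∣polar∣≤polar⁺ : ∀ c x₀ x₁ y₀ y₁ → ∣ polar (+ c) (+ x₀) (+ x₁) (+ y₀) (+ y₁) ∣ ≤ polar⁺ c x₀ x₁ y₀ y₁
∣polar∣≤polar⁺ c x₀ x₁ y₀ y₁ =
  ≤-trans (∣i-j+k∣≤∣i∣+∣j∣+∣k∣ (+ 2 ℤ.* + x₁ ℤ.* + y₁) (+ c ℤ.* (+ x₀ ℤ.* + y₁ ℤ.+ + x₁ ℤ.* + y₀))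
                                (+ 2 ℤ.* + x₀ ℤ.* + y₀))
  (+-mono-≤ (+-mono-≤ (≤-reflexive (∣i*j*k∣≡∣i∣*∣j∣*∣k∣ (+ 2) (+ x₁) (+ y₁))) middle)
            (≤-reflexive (∣i*j*k∣≡∣i∣*∣j∣*∣k∣ (+ 2) (+ x₀) (+ y₀))))
  where
  middle : ∣ + c ℤ.* (+ x₀ ℤ.* + y₁ ℤ.+ + x₁ ℤ.* + y₀) ∣ ≤ c * (x₀ * y₁ + x₁ * y₀)
  middle = ≤-trans (≤-reflexive (ℤP.abs-* (+ c) _))
             (*-monoʳ-≤ c (≤-trans (ℤP.∣i+j∣≤∣i∣+∣j∣ (+ x₀ ℤ.* + y₁) (+ x₁ ℤ.* + y₀))
                                   (≤-reflexive (cong₂ _+_ (ℤP.abs-* (+ x₀) (+ y₁)) (ℤP.abs-* (+ x₁) (+ y₀))))))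

∣form∣≤polar⁺ : ∀ c a b → ∣ form (+ c) (+ a) (+ b) ∣ ≤ polar⁺ c a b a b
∣form∣≤polar⁺ c a b = begin
  ∣ form (+ c) (+ a) (+ b) ∣          ≤⟨ m≤n*m _ 2 ⟩
  2 * ∣ form (+ c) (+ a) (+ b) ∣      ≡⟨ sym (ℤP.abs-* (+ 2) (form (+ c) (+ a) (+ b))) ⟩
  ∣ + 2 ℤ.* form (+ c) (+ a) (+ b) ∣  ≡⟨ cong ∣_∣ (2*form≡polar (+ c) (+ a) (+ b)) ⟩
  ∣ polar (+ c) (+ a) (+ b) (+ a) (+ b) ∣ ≤⟨ ∣polar∣≤polar⁺ c a b a b ⟩
  polar⁺ c a b a b                    ∎
  where open ≤-Reasoning

polar⁺-mono : ∀ c {x₀ x₁ y₀ y₁ x₀′ x₁′ y₀′ y₁′} → x₀ ≤ x₀′ → x₁ ≤ x₁′ → y₀ ≤ y₀′ → y₁ ≤ y₁′ →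
              polar⁺ c x₀ x₁ y₀ y₁ ≤ polar⁺ c x₀′ x₁′ y₀′ y₁′
polar⁺-mono c x₀≤ x₁≤ y₀≤ y₁≤ =
  +-mono-≤ (+-mono-≤ (*-mono-≤ (*-monoʳ-≤ 2 x₁≤) y₁≤)
                     (*-monoʳ-≤ c (+-mono-≤ (*-mono-≤ x₀≤ y₁≤) (*-mono-≤ x₁≤ y₀≤))))
           (*-mono-≤ (*-monoʳ-≤ 2 x₀≤) y₀≤)

polar⁺-bound : ∀ c {x₀ x₁ y₀ y₁ a b} → x₀ ≤ a → x₁ ≤ a → y₀ ≤ b → y₁ ≤ b →
               polar⁺ c x₀ x₁ y₀ y₁ ≤ 2 * (c + 2) * (a * b)
polar⁺-bound c {a = a} {b} x₀≤ x₁≤ y₀≤ y₁≤ =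
  ≤-trans (polar⁺-mono c x₀≤ x₁≤ y₀≤ y₁≤) (≤-reflexive (expanded c a b))
  where
  expanded : ∀ c a b → 2 * a * b + c * (a * b + a * b) + 2 * a * b ≡ 2 * (c + 2) * (a * b)
  expanded = ℕ-Ring.solve-∀

polar⁺-scaleʳ : ∀ c x₀ x₁ y₀ y₁ k → k * polar⁺ c x₀ x₁ y₀ y₁ ≡ polar⁺ c x₀ x₁ (k * y₀) (k * y₁)
polar⁺-scaleʳ = expanded
  where
  expanded : ∀ c x₀ x₁ y₀ y₁ k →
    k * (2 * x₁ * y₁ + c * (x₀ * y₁ + x₁ * y₀) + 2 * x₀ * y₀)
      ≡ 2 * x₁ * (k * y₁) + c * (x₀ * (k * y₁) + x₁ * (k * y₀)) + 2 * x₀ * (k * y₀)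
  expanded = ℕ-Ring.solve-∀

polar⁺-scale : ∀ c a b k → k * k * polar⁺ c a b a b ≡ polar⁺ c (k * a) (k * b) (k * a) (k * b)
polar⁺-scale = expanded
  where
  expanded : ∀ c a b k →
    k * k * (2 * b * b + c * (a * b + b * a) + 2 * a * a)
      ≡ 2 * (k * b) * (k * b) + c * ((k * a) * (k * b) + (k * b) * (k * a)) + 2 * (k * a) * (k * a)
  expanded = ℕ-Ring.solve-∀

∣s⁴*i∣≡s⁴*∣i∣ : ∀ s i → ∣ + s ℤ.* + s ℤ.* + s ℤ.* + s ℤ.* i ∣ ≡ s * s * s * s * ∣ i ∣
∣s⁴*i∣≡s⁴*∣i∣ s i = trans (ℤP.abs-* (+ s ℤ.* + s ℤ.* + s ℤ.* + s) i)
  (cong (_* ∣ i ∣) (trans (ℤP.abs-* (+ s ℤ.* + s ℤ.* + s) (+ s)) (cong (_* s) (∣i*j*k∣≡∣i∣*∣j∣*∣k∣ (+ s) (+ s) (+ s)))))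

-- With G = s²I + p²J and u = s²M − p², the identity
-- s⁴((I + MJ)² − Mb²) = (G − spb)(G + spb) + 2G(uJ) + (uJ)² − s²(ub)b
-- holds because s²(I + MJ) = G + uJ and s²M = p² + u.
norm-bound : ∀ (s p M : ℕ) (I J b : ℤ) → p * p ≤ s * s * M →
  let u = s * s * M ∸ p * p
      G = + s ℤ.* + s ℤ.* I ℤ.+ + p ℤ.* + p ℤ.* J
      spb = + s ℤ.* + p ℤ.* b
  in s * s * s * s * ∣ (I ℤ.+ + M ℤ.* J) ℤ.* (I ℤ.+ + M ℤ.* J) ℤ.- + M ℤ.* (b ℤ.* b) ∣
     ≤ ∣ G ℤ.- spb ∣ * ∣ G ℤ.+ spb ∣
       + (2 * ∣ G ∣ * (u * ∣ J ∣) + (u * ∣ J ∣) * (u * ∣ J ∣) + s * s * (u * ∣ b ∣) * ∣ b ∣)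
norm-bound s p M I J b p²≤s²M = begin
  s * s * s * s * ∣ N ∣                        ≡⟨ sym (∣s⁴*i∣≡s⁴*∣i∣ s N) ⟩
  ∣ + s ℤ.* + s ℤ.* + s ℤ.* + s ℤ.* N ∣        ≡⟨ cong ∣_∣ (expansion (+ s) (+ p) (+ M) I J b) ⟩
  ∣ rhs (+ s ℤ.* + s ℤ.* + M ℤ.- + p ℤ.* + p) ∣ ≡⟨ cong (λ U → ∣ rhs U ∣) (sym U≡u) ⟩
  ∣ rhs (+ u) ∣                                ≤⟨ ∣i+j+k-l∣≤∣i∣+[∣j∣+∣k∣+∣l∣] ((G ℤ.- spb) ℤ.* (G ℤ.+ spb))
                                                   (+ 2 ℤ.* G ℤ.* (+ u ℤ.* J)) ((+ u ℤ.* J) ℤ.* (+ u ℤ.* J))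
                                                   (+ s ℤ.* + s ℤ.* (+ u ℤ.* b) ℤ.* b) ⟩
  ∣ (G ℤ.- spb) ℤ.* (G ℤ.+ spb) ∣
    + (∣ + 2 ℤ.* G ℤ.* (+ u ℤ.* J) ∣ + ∣ (+ u ℤ.* J) ℤ.* (+ u ℤ.* J) ∣
       + ∣ + s ℤ.* + s ℤ.* (+ u ℤ.* b) ℤ.* b ∣) ≡⟨ cong₂ _+_ (ℤP.abs-* (G ℤ.- spb) (G ℤ.+ spb))
                                                  (cong₂ _+_ (cong₂ _+_ t₂ t₃) t₄) ⟩
  ∣ G ℤ.- spb ∣ * ∣ G ℤ.+ spb ∣
    + (2 * ∣ G ∣ * (u * ∣ J ∣) + (u * ∣ J ∣) * (u * ∣ J ∣) + s * s * (u * ∣ b ∣) * ∣ b ∣) ∎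
  where
  open ≤-Reasoning
  u : ℕ
  u = s * s * M ∸ p * p
  G spb N : ℤ
  G = + s ℤ.* + s ℤ.* I ℤ.+ + p ℤ.* + p ℤ.* J
  spb = + s ℤ.* + p ℤ.* b
  N = (I ℤ.+ + M ℤ.* J) ℤ.* (I ℤ.+ + M ℤ.* J) ℤ.- + M ℤ.* (b ℤ.* b)
  rhs : ℤ → ℤ
  rhs U = (G ℤ.- spb) ℤ.* (G ℤ.+ spb) ℤ.+ + 2 ℤ.* G ℤ.* (U ℤ.* J) ℤ.+ (U ℤ.* J) ℤ.* (U ℤ.* J)
          ℤ.- + s ℤ.* + s ℤ.* (U ℤ.* b) ℤ.* b
  expansion : ∀ s p M I J b →
    s ℤ.* s ℤ.* s ℤ.* s ℤ.* ((I ℤ.+ M ℤ.* J) ℤ.* (I ℤ.+ M ℤ.* J) ℤ.- M ℤ.* (b ℤ.* b))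
    ≡ ((s ℤ.* s ℤ.* I ℤ.+ p ℤ.* p ℤ.* J) ℤ.- s ℤ.* p ℤ.* b) ℤ.* ((s ℤ.* s ℤ.* I ℤ.+ p ℤ.* p ℤ.* J) ℤ.+ s ℤ.* p ℤ.* b)
      ℤ.+ + 2 ℤ.* (s ℤ.* s ℤ.* I ℤ.+ p ℤ.* p ℤ.* J) ℤ.* ((s ℤ.* s ℤ.* M ℤ.- p ℤ.* p) ℤ.* J)
      ℤ.+ ((s ℤ.* s ℤ.* M ℤ.- p ℤ.* p) ℤ.* J) ℤ.* ((s ℤ.* s ℤ.* M ℤ.- p ℤ.* p) ℤ.* J)
      ℤ.- s ℤ.* s ℤ.* ((s ℤ.* s ℤ.* M ℤ.- p ℤ.* p) ℤ.* b) ℤ.* b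
  expansion = ℤ-Ring.solve-∀
  U≡u : + u ≡ + s ℤ.* + s ℤ.* + M ℤ.- + p ℤ.* + p
  U≡u = trans (pos-∸ p²≤s²M) (cong₂ ℤ._-_ (trans (ℤP.pos-* (s * s) M) (cong (ℤ._* + M) (ℤP.pos-* s s)))
                                          (ℤP.pos-* p p))
  t₂ : ∣ + 2 ℤ.* G ℤ.* (+ u ℤ.* J) ∣ ≡ 2 * ∣ G ∣ * (u * ∣ J ∣)
  t₂ = trans (∣i*j*k∣≡∣i∣*∣j∣*∣k∣ (+ 2) G (+ u ℤ.* J)) (cong (2 * ∣ G ∣ *_) (ℤP.abs-* (+ u) J))
  t₃ : ∣ (+ u ℤ.* J) ℤ.* (+ u ℤ.* J) ∣ ≡ (u * ∣ J ∣) * (u * ∣ J ∣)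
  t₃ = trans (ℤP.abs-* (+ u ℤ.* J) (+ u ℤ.* J)) (cong₂ _*_ (ℤP.abs-* (+ u) J) (ℤP.abs-* (+ u) J))
  t₄ : ∣ + s ℤ.* + s ℤ.* (+ u ℤ.* b) ℤ.* b ∣ ≡ s * s * (u * ∣ b ∣) * ∣ b ∣
  t₄ = trans (∣i*j*k∣≡∣i∣*∣j∣*∣k∣ (+ s ℤ.* + s) (+ u ℤ.* b) b)
             (cong₂ (λ a b′ → a * b′ * ∣ b ∣) (ℤP.abs-* (+ s) (+ s)) (ℤP.abs-* (+ u) b))

norm-zero : ∀ {M} → NotRatioOfSquares M → ∀ A b → ∣ A ℤ.* A ℤ.- + M ℤ.* (b ℤ.* b) ∣ ≡ 0 → A ≡ + 0
norm-zero {M} irrational A b ∣N∣≡0 = ℤP.∣i∣≡0⇒i≡0 (irrational ∣ A ∣ ∣ b ∣ (begin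
  ∣ A ∣ * ∣ A ∣           ≡⟨ sym (ℤP.abs-* A A) ⟩
  ∣ A ℤ.* A ∣             ≡⟨ cong ∣_∣ (ℤP.i-j≡0⇒i≡j (A ℤ.* A) (+ M ℤ.* (b ℤ.* b)) (ℤP.∣i∣≡0⇒i≡0 ∣N∣≡0)) ⟩
  ∣ + M ℤ.* (b ℤ.* b) ∣   ≡⟨ ℤP.abs-* (+ M) (b ℤ.* b) ⟩
  M * ∣ b ℤ.* b ∣         ≡⟨ cong (M *_) (ℤP.abs-* b b) ⟩
  M * (∣ b ∣ * ∣ b ∣)     ∎))
  where open ≡-Reasoning

no-small-multiple : ∀ {M K} J → 0 < K → K < M → ℤ.- + K ℤ.+ + M ℤ.* J ≢ + 0
no-small-multiple {M} {K} J 0<K K<M eq = <⇒≱ K<M (∣⇒≤ {{>-nonZero 0<K}} (divides ∣ J ∣ K≡∣J∣*M))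
  where
  shift : ∀ k j → j ≡ (ℤ.- k ℤ.+ j) ℤ.+ k
  shift = ℤ-Ring.solve-∀
  MJ≡K : + M ℤ.* J ≡ + K
  MJ≡K = trans (shift (+ K) (+ M ℤ.* J)) (trans (cong (ℤ._+ + K) eq) (ℤP.+-identityˡ (+ K)))
  K≡∣J∣*M : K ≡ ∣ J ∣ * M
  K≡∣J∣*M = trans (cong ∣_∣ (sym MJ≡K)) (trans (ℤP.abs-* (+ M) J) (*-comm M ∣ J ∣))

-- Rational approximation of √M

scaled-floor-error : ∀ {M s p x q} → p * p ≤ s * s * M → s * s * M < suc p * suc p →
  q * q * M ≤ x * x → (x ∸ 2) * (x ∸ 2) ≤ q * q * M → p * q ≤ s * x × s * x ≤ s + s + q + p * q
scaled-floor-error {M} {s} {p} {x} {q} p²≤s²M s²M<[p+1]² q²M≤x² [x-2]²≤q²M =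
  m*m≤n*n⇒m≤n [pq]²≤[sx]² , sx≤
  where
  open ≤-Reasoning
  swap : ∀ s q M → (s * s * M) * (q * q) ≡ (q * q * M) * (s * s)
  swap = ℕ-Ring.solve-∀
  [pq]²≤[sx]² : (p * q) * (p * q) ≤ (s * x) * (s * x)
  [pq]²≤[sx]² = begin
    (p * q) * (p * q)      ≡⟨ [m*n]*[m*n]≡m*m*[n*n] p q ⟩
    (p * p) * (q * q)      ≤⟨ *-monoˡ-≤ (q * q) p²≤s²M ⟩
    (s * s * M) * (q * q)  ≡⟨ swap s q M ⟩
    (q * q * M) * (s * s)  ≤⟨ *-monoˡ-≤ (s * s) q²M≤x² ⟩
    (x * x) * (s * s)      ≡⟨ trans (*-comm (x * x) (s * s)) (sym ([m*n]*[m*n]≡m*m*[n*n] s x)) ⟩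
    (s * x) * (s * x)      ∎
  y : ℕ
  y = x ∸ 2
  [sy]²≤[q[p+1]]² : (s * y) * (s * y) ≤ (q * suc p) * (q * suc p)
  [sy]²≤[q[p+1]]² = begin
    (s * y) * (s * y)          ≡⟨ [m*n]*[m*n]≡m*m*[n*n] s y ⟩
    (s * s) * (y * y)          ≤⟨ *-monoʳ-≤ (s * s) [x-2]²≤q²M ⟩
    (s * s) * (q * q * M)      ≡⟨ trans (*-comm (s * s) _) (sym (swap s q M)) ⟩
    (s * s * M) * (q * q)      ≡⟨ *-comm (s * s * M) (q * q) ⟩
    (q * q) * (s * s * M)      ≤⟨ *-monoʳ-≤ (q * q) (<⇒≤ s²M<[p+1]²) ⟩
    (q * q) * (suc p * suc p)  ≡⟨ sym ([m*n]*[m*n]≡m*m*[n*n] q (suc p)) ⟩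
    (q * suc p) * (q * suc p)  ∎
  regroup : ∀ s y q p → s * (y + 2) ≡ s * y + (s + s) × q * suc p + (s + s) ≡ s + s + q + p * q
  regroup s y q p = solve₁ s y , solve₂ s q p
    where
    solve₁ : ∀ s y → s * (y + 2) ≡ s * y + (s + s)
    solve₁ = ℕ-Ring.solve-∀
    solve₂ : ∀ s q p → q * (1 + p) + (s + s) ≡ s + s + q + p * q
    solve₂ = ℕ-Ring.solve-∀
  sx≤ : s * x ≤ s + s + q + p * q
  sx≤ = begin
    s * x                  ≤⟨ *-monoʳ-≤ s (≤-trans (m≤n+m∸n x 2) (≤-reflexive (+-comm 2 y))) ⟩
    s * (y + 2)            ≡⟨ proj₁ (regroup s y q p) ⟩
    s * y + (s + s)        ≤⟨ +-monoˡ-≤ (s + s) (m*m≤n*n⇒m≤n {s * y} {q * suc p} [sy]²≤[q[p+1]]²) ⟩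
    q * suc p + (s + s)    ≡⟨ proj₂ (regroup s y q p) ⟩
    s + s + q + p * q      ∎

c*[s+s+X]<p : ∀ {c M s p X} → (c + c + 1) * (c + c + 1) ≤ M → suc (c * X) ≤ s →
                    s * s * M < suc p * suc p → c * (s + s + X) < p
c*[s+s+X]<p {c} {M} {s} {p} {X} [2c+1]²≤M cX<s s²M<[p+1]² = ≰⇒> λ p≤ → <⇒≱ s²M<[p+1]² (begin
  suc p * suc p                           ≤⟨ *-mono-≤ (p+1≤ p≤) (p+1≤ p≤) ⟩
  ((c + c + 1) * s) * ((c + c + 1) * s)   ≡⟨ [m*n]*[m*n]≡m*m*[n*n] (c + c + 1) s ⟩
  (c + c + 1) * (c + c + 1) * (s * s)     ≤⟨ *-monoˡ-≤ (s * s) [2c+1]²≤M ⟩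
  M * (s * s)                             ≡⟨ *-comm M (s * s) ⟩
  s * s * M                               ∎)
  where
  open ≤-Reasoning
  regroup : ∀ c s X → 1 + c * (s + s + X) ≡ c * s + c * s + (1 + c * X) × c * s + c * s + s ≡ (c + c + 1) * s
  regroup c s X = solve₁ c s X , solve₂ c s
    where
    solve₁ : ∀ c s X → 1 + c * (s + s + X) ≡ c * s + c * s + (1 + c * X)
    solve₁ = ℕ-Ring.solve-∀
    solve₂ : ∀ c s → c * s + c * s + s ≡ (c + c + 1) * s
    solve₂ = ℕ-Ring.solve-∀
  p+1≤ : p ≤ c * (s + s + X) → suc p ≤ (c + c + 1) * s
  p+1≤ p≤ = begin
    suc p                         ≤⟨ s≤s p≤ ⟩
    1 + c * (s + s + X)           ≡⟨ proj₁ (regroup c s X) ⟩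
    c * s + c * s + (1 + c * X)   ≤⟨ +-monoʳ-≤ (c * s + c * s) cX<s ⟩
    c * s + c * s + s             ≡⟨ proj₂ (regroup c s X) ⟩
    (c + c + 1) * s               ∎

step-of-remainders : ∀ {c s p e₀ e₁ e₂ q₀ q₁ q₂ x₀ x₁ x₂} →
  e₀ + p * q₀ ≡ s * x₀ → e₁ + p * q₁ ≡ s * x₁ → e₂ + p * q₂ ≡ s * x₂ → x₂ + x₀ ≡ c * x₁ →
  e₂ + e₀ < p → c * e₁ < p → e₂ + e₀ ≡ c * e₁
step-of-remainders {c} {s} {p} {e₀} {e₁} {e₂} {q₀} {q₁} {q₂} {x₀} {x₁} {x₂} h₀ h₁ h₂ hx e₂+e₀<p ce₁<p =
  +-cancelʳ-≡ (p * (q₂ + q₀)) (e₂ + e₀) (c * e₁)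
    (trans combined (cong (λ t → c * e₁ + p * t) (sym (quotient-unique e₂+e₀<p ce₁<p combined))))
  where
  open ≡-Reasoning
  regroup₁ : ∀ e₂ e₀ p q₂ q₀ → (e₂ + e₀) + p * (q₂ + q₀) ≡ (e₂ + p * q₂) + (e₀ + p * q₀)
  regroup₁ = ℕ-Ring.solve-∀
  regroup₂ : ∀ s c x₁ → s * (c * x₁) ≡ c * (s * x₁)
  regroup₂ = ℕ-Ring.solve-∀
  regroup₃ : ∀ c e₁ p q₁ → c * (e₁ + p * q₁) ≡ c * e₁ + p * (c * q₁)
  regroup₃ = ℕ-Ring.solve-∀
  combined : (e₂ + e₀) + p * (q₂ + q₀) ≡ c * e₁ + p * (c * q₁)
  combined = begin
    (e₂ + e₀) + p * (q₂ + q₀)      ≡⟨ regroup₁ e₂ e₀ p q₂ q₀ ⟩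
    (e₂ + p * q₂) + (e₀ + p * q₀)  ≡⟨ cong₂ _+_ h₂ h₀ ⟩
    s * x₂ + s * x₀                ≡⟨ sym (*-distribˡ-+ s x₂ x₀) ⟩
    s * (x₂ + x₀)                  ≡⟨ cong (s *_) hx ⟩
    s * (c * x₁)                   ≡⟨ regroup₂ s c x₁ ⟩
    c * (s * x₁)                   ≡⟨ cong (c *_) (sym h₁) ⟩
    c * (e₁ + p * q₁)              ≡⟨ regroup₃ c e₁ p q₁ ⟩
    c * e₁ + p * (c * q₁)          ∎

-- Solutions of the recurrence

Step : ℕ → (ℕ → ℕ) → ℕ → Set
Step c f i = f (suc (suc i)) + f i ≡ c * f (suc i)

step-ℤ : ∀ {c f i} → Step c f i → + f (suc (suc i)) ≡ + c ℤ.* + f (suc i) ℤ.- + f i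
step-ℤ {c} {f} {i} step = begin
  + f (suc (suc i))                     ≡⟨ cong +_ (sym (m+n∸n≡m (f (suc (suc i))) (f i))) ⟩
  + (f (suc (suc i)) + f i ∸ f i)       ≡⟨ cong (λ t → + (t ∸ f i)) step ⟩
  + (c * f (suc i) ∸ f i)               ≡⟨ pos-∸ (subst (f i ≤_) step (m≤n+m (f i) (f (suc (suc i))))) ⟩
  + (c * f (suc i)) ℤ.- + f i           ≡⟨ cong (ℤ._- + f i) (ℤP.pos-* c (f (suc i))) ⟩
  + c ℤ.* + f (suc i) ℤ.- + f i         ∎
  where open ≡-Reasoning

form-step-ℕ : ∀ {c f i} → Step c f i →
              form (+ c) (+ f (suc i)) (+ f (suc (suc i))) ≡ form (+ c) (+ f i) (+ f (suc i))
form-step-ℕ {c} {f} {i} step =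
  trans (cong (form (+ c) (+ f (suc i))) (step-ℤ {c} {f} {i} step)) (form-step (+ c) (+ f i) (+ f (suc i)))

form-conserved : ∀ {c} f n → (∀ i → i < n → Step c f i) →
                 form (+ c) (+ f n) (+ f (suc n)) ≡ form (+ c) (+ f 0) (+ f 1)
form-conserved f zero _ = refl
form-conserved {c} f (suc n) steps =
  trans (form-step-ℕ {c} {f} (steps n ≤-refl)) (form-conserved {c} f n (λ i i<n → steps i (m<n⇒m<1+n i<n)))

-- d = c − 1 is the factor by which a nonnegative solution of f (i + 2) = c f (i + 1) − f i grows
-- once it starts increasing.
module Lucas (d : ℕ) .{{_ : NonZero d}} where

  c : ℕ
  c = suc d

  step-growth : ∀ {a b m} → a + b ≡ c * m → b ≤ m → d * m ≤ a
  step-growth {a} {b} {m} eq b≤m = +-cancelˡ-≤ m (d * m) a (begin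
    m + d * m  ≡⟨ sym eq ⟩
    a + b      ≤⟨ +-monoʳ-≤ a b≤m ⟩
    a + m      ≡⟨ +-comm a m ⟩
    m + a      ∎)
    where open ≤-Reasoning

  grows-forward : ∀ f h k → (∀ i → i < k → Step c f (i + h)) → f h ≤ f (suc h) →
                  d ^ k * f (suc h) ≤ f (suc (k + h)) × f (k + h) ≤ f (suc (k + h))
  grows-forward f h zero _ up = ≤-reflexive (*-identityˡ (f (suc h))) , up
  grows-forward f h (suc k) steps up =
    ≤-trans (≤-reflexive (*-assoc d (d ^ k) (f (suc h)))) (≤-trans (*-monoʳ-≤ d ih-growth) growth) ,
    ≤-trans (m≤n*m _ d) growth
    where
    ih : d ^ k * f (suc h) ≤ f (suc (k + h)) × f (k + h) ≤ f (suc (k + h))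
    ih = grows-forward f h k (λ i i<k → steps i (m<n⇒m<1+n i<k)) up
    ih-growth : d ^ k * f (suc h) ≤ f (suc (k + h))
    ih-growth = proj₁ ih
    growth : d * f (suc (k + h)) ≤ f (suc (suc (k + h)))
    growth = step-growth (steps k ≤-refl) (proj₂ ih)

  grows-backward : ∀ f j → (∀ i → i < j → Step c f i) → f (suc j) ≤ f j → d ^ j * f j ≤ f 0
  grows-backward f zero _ _ = ≤-reflexive (*-identityˡ (f 0))
  grows-backward f (suc j) steps down = begin
    d * d ^ j * f (suc j)    ≡⟨ cong (_* f (suc j)) (*-comm d (d ^ j)) ⟩
    d ^ j * d * f (suc j)    ≡⟨ *-assoc (d ^ j) d (f (suc j)) ⟩
    d ^ j * (d * f (suc j))  ≤⟨ *-monoʳ-≤ (d ^ j) shrink ⟩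
    d ^ j * f j              ≤⟨ grows-backward f j (λ i i<j → steps i (m<n⇒m<1+n i<j))
                                  (≤-trans (m≤n*m _ d) shrink) ⟩
    f 0                      ∎
    where
    open ≤-Reasoning
    shrink : d * f (suc j) ≤ f j
    shrink = step-growth (trans (+-comm (f j) (f (suc (suc j)))) (steps j ≤-refl)) down

  window-decay : ∀ f h {B} → (∀ i → i < h + h → Step c f i) → (∀ i → i ≤ suc (h + h) → f i ≤ B) →
                 d ^ h * f h ≤ B × d ^ h * f (suc h) ≤ B
  window-decay f h {B} steps bounded with ≤-total (f h) (f (suc h))
  ... | inj₁ up = ≤-trans (*-monoʳ-≤ (d ^ h) up) last , last
    where
    last : d ^ h * f (suc h) ≤ B
    last = ≤-trans (proj₁ (grows-forward f h h (λ i i<h → steps (i + h) (+-monoˡ-< h i<h)) up))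
                   (bounded (suc (h + h)) ≤-refl)
  ... | inj₂ down = first , ≤-trans (*-monoʳ-≤ (d ^ h) down) first
    where
    first : d ^ h * f h ≤ B
    first = ≤-trans (grows-backward f h (λ i i<h → steps i (≤-trans i<h (m≤m+n h h))) down)
                    (bounded 0 z≤n)

  module CloseWindow
    (M K : ℕ) (M-irrational : NotRatioOfSquares M) (0<K : 0 < K) (K<M : K < M)
    (M-large : (c + c + 1) * (c + c + 1) ≤ M)
    (X q : ℕ → ℕ) (X-step : ∀ i → Step c X i) (X-ascending : ∀ i → X i ≤ X (suc i))
    (X-form : form (+ c) (+ X 0) (+ X 1) ≡ ℤ.- + K)
    (q-below : ∀ i → q i * q i * M ≤ X i * X i)
    (h : ℕ) (h-large : 17 * ((c + 2) * X 1) ≤ d ^ h)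
    (close : ∀ i → i ≤ suc (h + h) → (X i ∸ 2) * (X i ∸ 2) ≤ q i * q i * M)
    where

    instance
      M≢0 : NonZero M
      M≢0 = >-nonZero (≤-<-trans z≤n K<M)

    top Y R V Z s : ℕ
    top = suc (h + h)
    Y = X 1
    R = c + 2
    V = R * (Y * Y)
    Z = 8 * V * (K + 5 * V)
    s = suc (c * X top + 2 * Z)

    -- p / s approximates √M from below, and E i approximates s (X i − q i √M) ≥ 0.
    root : ∃[ p ] p * p * 1 ≤ s * s * M × s * s * M < suc p * suc p * 1
    root = floor-root 1 (s * s * M)

    p : ℕ
    p = proj₁ root

    p²≤s²M : p * p ≤ s * s * M
    p²≤s²M = subst (_≤ s * s * M) (*-identityʳ (p * p)) (proj₁ (proj₂ root))

    s²M<[p+1]² : s * s * M < suc p * suc p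
    s²M<[p+1]² = subst (s * s * M <_) (*-identityʳ (suc p * suc p)) (proj₂ (proj₂ root))

    q≤X : ∀ i → q i ≤ X i
    q≤X i = m*m≤n*n⇒m≤n (≤-trans (m≤m*n (q i * q i) M) (q-below i))

    X≤Xtop : ∀ {i} → i ≤ top → X i ≤ X top
    X≤Xtop = ascending⇒monotone X X-ascending

    sX-bounds : ∀ {i} → i ≤ top → p * q i ≤ s * X i × s * X i ≤ s + s + q i + p * q i
    sX-bounds {i} i≤top = scaled-floor-error {M} {s} {p} {X i} {q i} p²≤s²M s²M<[p+1]² (q-below i) (close i i≤top)

    E F : ℕ → ℕ
    E i = s * X i ∸ p * q i
    F i = s * X i + p * q i

    E+pq≡sX : ∀ {i} → i ≤ top → E i + p * q i ≡ s * X i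
    E+pq≡sX i≤top = m∸n+n≡m (proj₁ (sX-bounds i≤top))

    B : ℕ
    B = s + s + X top

    E≤B : ∀ {i} → i ≤ top → E i ≤ B
    E≤B {i} i≤top = begin
      E i                                ≤⟨ ∸-monoˡ-≤ (p * q i) (proj₂ (sX-bounds i≤top)) ⟩
      s + s + q i + p * q i ∸ p * q i    ≡⟨ m+n∸n≡m (s + s + q i) (p * q i) ⟩
      s + s + q i                        ≤⟨ +-monoʳ-≤ (s + s) (≤-trans (q≤X i) (X≤Xtop i≤top)) ⟩
      B                                  ∎
      where open ≤-Reasoning

    B≤3s : B ≤ s + s + s
    B≤3s = +-monoʳ-≤ (s + s) (≤-trans (m≤n*m (X top) c) (≤-trans (m≤m+n (c * X top) (2 * Z)) (n≤1+n _)))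

    cB<p : c * B < p
    cB<p = c*[s+s+X]<p {c} {M} {s} {p} {X top} M-large (s≤s (m≤m+n (c * X top) (2 * Z))) s²M<[p+1]²

    E-step : ∀ i → i < h + h → Step c E i
    E-step i i<2h = step-of-remainders {c} {s} {p} {E i} {E (suc i)} {E (suc (suc i))}
      {q i} {q (suc i)} {q (suc (suc i))} {X i} {X (suc i)} {X (suc (suc i))}
      (E+pq≡sX i≤top) (E+pq≡sX i+1≤top) (E+pq≡sX i+2≤top) (X-step i)
      (≤-<-trans (≤-trans (+-mono-≤ (E≤B i+2≤top) (E≤B i≤top)) (+-monoʳ-≤ B (m≤n*m B d))) cB<p)
      (≤-<-trans (*-monoʳ-≤ c (E≤B i+1≤top)) cB<p)
      where
      i+2≤top : suc (suc i) ≤ top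
      i+2≤top = s≤s i<2h
      i+1≤top : suc i ≤ top
      i+1≤top = ≤-trans (n≤1+n (suc i)) i+2≤top
      i≤top : i ≤ top
      i≤top = ≤-trans (n≤1+n i) i+1≤top

    D : ℕ
    D = d ^ h

    E-small : D * E h ≤ s + s + s × D * E (suc h) ≤ s + s + s
    E-small = let (decay₀ , decay₁) = window-decay E h E-step (λ i i≤top → E≤B i≤top)
              in ≤-trans decay₀ B≤3s , ≤-trans decay₁ B≤3s

    I J b G spb : ℤ
    I = form (+ c) (+ X 0) (+ X 1)
    J = form (+ c) (+ q 0) (+ q 1)
    b = polar (+ c) (+ X 0) (+ X 1) (+ q 0) (+ q 1)
    G = + s ℤ.* + s ℤ.* I ℤ.+ + p ℤ.* + p ℤ.* J
    spb = + s ℤ.* + p ℤ.* b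

    formE≡G-spb : form (+ c) (+ E h) (+ E (suc h)) ≡ G ℤ.- spb
    formE≡G-spb = begin
      form (+ c) (+ E h) (+ E (suc h))  ≡⟨ form-conserved {c} E h (λ i i<h → E-step i (≤-trans i<h (m≤m+n h h))) ⟩
      form (+ c) (+ E 0) (+ E 1)        ≡⟨ cong₂ (form (+ c)) (E-ℤ z≤n) (E-ℤ (s≤s z≤n)) ⟩
      form (+ c) (+ s ℤ.* + X 0 ℤ.- + p ℤ.* + q 0) (+ s ℤ.* + X 1 ℤ.- + p ℤ.* + q 1)
                                        ≡⟨ form-of-difference (+ c) (+ s) (+ p) (+ X 0) (+ X 1) (+ q 0) (+ q 1) ⟩
      G ℤ.- spb                         ∎
      where
      open ≡-Reasoning
      E-ℤ : ∀ {i} → i ≤ top → + E i ≡ + s ℤ.* + X i ℤ.- + p ℤ.* + q i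
      E-ℤ {i} i≤top = trans (pos-∸ (proj₁ (sX-bounds i≤top))) (cong₂ ℤ._-_ (ℤP.pos-* s (X i)) (ℤP.pos-* p (q i)))

    formF≡G+spb : form (+ c) (+ F 0) (+ F 1) ≡ G ℤ.+ spb
    formF≡G+spb = trans (cong₂ (form (+ c)) (F-ℤ 0) (F-ℤ 1))
                        (form-of-sum (+ c) (+ s) (+ p) (+ X 0) (+ X 1) (+ q 0) (+ q 1))
      where
      F-ℤ : ∀ i → + F i ≡ + s ℤ.* + X i ℤ.+ + p ℤ.* + q i
      F-ℤ i = trans (ℤP.pos-+ (s * X i) (p * q i)) (cong₂ ℤ._+_ (ℤP.pos-* s (X i)) (ℤP.pos-* p (q i)))

    u : ℕ
    u = s * s * M ∸ p * p

    T₁ rest : ℕ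
    T₁ = ∣ form (+ c) (+ E h) (+ E (suc h)) ∣ * ∣ form (+ c) (+ F 0) (+ F 1) ∣
    rest = 2 * ∣ G ∣ * (u * ∣ J ∣) + (u * ∣ J ∣) * (u * ∣ J ∣) + s * s * (u * ∣ b ∣) * ∣ b ∣

    N : ℤ
    N = (I ℤ.+ + M ℤ.* J) ℤ.* (I ℤ.+ + M ℤ.* J) ℤ.- + M ℤ.* (b ℤ.* b)

    s⁴∣N∣≤T₁+rest : s * s * s * s * ∣ N ∣ ≤ T₁ + rest
    s⁴∣N∣≤T₁+rest = subst (λ t → s * s * s * s * ∣ N ∣ ≤ t + rest)
      (sym (cong₂ (λ e f → ∣ e ∣ * ∣ f ∣) formE≡G-spb formF≡G+spb)) (norm-bound s p M I J b p²≤s²M)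

    W : ℕ
    W = s * Y

    X₀≤Y : X 0 ≤ Y
    X₀≤Y = X-ascending 0

    q₀≤Y : q 0 ≤ Y
    q₀≤Y = ≤-trans (q≤X 0) X₀≤Y

    pq₀≤W : p * q 0 ≤ W
    pq₀≤W = ≤-trans (proj₁ (sX-bounds z≤n)) (*-monoʳ-≤ s X₀≤Y)

    pq₁≤W : p * q 1 ≤ W
    pq₁≤W = proj₁ (sX-bounds (s≤s z≤n))

    u≤2p : u ≤ p + p
    u≤2p = begin
      s * s * M ∸ p * p        ≤⟨ ∸-monoˡ-≤ (p * p) (s≤s⁻¹ (subst (s * s * M <_) (square-suc p) s²M<[p+1]²)) ⟩
      p * p + (p + p) ∸ p * p  ≡⟨ m+n∸m≡n (p * p) (p + p) ⟩
      p + p                    ∎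
      where
      open ≤-Reasoning
      square-suc : ∀ p → suc p * suc p ≡ 1 + (p * p + (p + p))
      square-suc = ℕ-Ring.solve-∀

    ∣J∣≤ : ∣ J ∣ ≤ polar⁺ c (q 0) (q 1) (q 0) (q 1)
    ∣J∣≤ = ∣form∣≤polar⁺ c (q 0) (q 1)

    p²∣J∣≤ : p * p * ∣ J ∣ ≤ 2 * R * (W * W)
    p²∣J∣≤ = begin
      p * p * ∣ J ∣                                      ≤⟨ *-monoʳ-≤ (p * p) ∣J∣≤ ⟩
      p * p * polar⁺ c (q 0) (q 1) (q 0) (q 1)           ≡⟨ polar⁺-scale c (q 0) (q 1) p ⟩
      polar⁺ c (p * q 0) (p * q 1) (p * q 0) (p * q 1)   ≤⟨ polar⁺-bound c pq₀≤W pq₁≤W pq₀≤W pq₁≤W ⟩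
      2 * R * (W * W)                                    ∎
      where open ≤-Reasoning

    u∣J∣≤ : u * ∣ J ∣ ≤ 2 * (2 * R * (Y * W))
    u∣J∣≤ = ≤-double {u} {p} {∣ J ∣} u≤2p (begin
      p * ∣ J ∣                                  ≤⟨ *-monoʳ-≤ p ∣J∣≤ ⟩
      p * polar⁺ c (q 0) (q 1) (q 0) (q 1)       ≡⟨ polar⁺-scaleʳ c (q 0) (q 1) (q 0) (q 1) p ⟩
      polar⁺ c (q 0) (q 1) (p * q 0) (p * q 1)   ≤⟨ polar⁺-bound c q₀≤Y (q≤X 1) pq₀≤W pq₁≤W ⟩
      2 * R * (Y * W)                            ∎)
      where open ≤-Reasoning

    ∣b∣≤ : ∣ b ∣ ≤ 2 * R * (Y * Y)
    ∣b∣≤ = ≤-trans (∣polar∣≤polar⁺ c (X 0) (X 1) (q 0) (q 1)) (polar⁺-bound c X₀≤Y ≤-refl q₀≤Y (q≤X 1))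

    u∣b∣≤ : u * ∣ b ∣ ≤ 2 * (2 * R * (Y * W))
    u∣b∣≤ = ≤-double {u} {p} {∣ b ∣} u≤2p (begin
      p * ∣ b ∣                                  ≤⟨ *-monoʳ-≤ p (∣polar∣≤polar⁺ c (X 0) (X 1) (q 0) (q 1)) ⟩
      p * polar⁺ c (X 0) (X 1) (q 0) (q 1)       ≡⟨ polar⁺-scaleʳ c (X 0) (X 1) (q 0) (q 1) p ⟩
      polar⁺ c (X 0) (X 1) (p * q 0) (p * q 1)   ≤⟨ polar⁺-bound c X₀≤Y ≤-refl pq₀≤W pq₁≤W ⟩
      2 * R * (Y * W)                            ∎)
      where open ≤-Reasoning

    ∣G∣≤ : ∣ G ∣ ≤ s * s * K + 2 * R * (W * W)
    ∣G∣≤ = begin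
      ∣ G ∣                                          ≤⟨ ℤP.∣i+j∣≤∣i∣+∣j∣ (+ s ℤ.* + s ℤ.* I) (+ p ℤ.* + p ℤ.* J) ⟩
      ∣ + s ℤ.* + s ℤ.* I ∣ + ∣ + p ℤ.* + p ℤ.* J ∣  ≡⟨ cong₂ _+_ (∣i*j*k∣≡∣i∣*∣j∣*∣k∣ (+ s) (+ s) I)
                                                                 (∣i*j*k∣≡∣i∣*∣j∣*∣k∣ (+ p) (+ p) J) ⟩
      s * s * ∣ I ∣ + p * p * ∣ J ∣                  ≡⟨ cong (λ t → s * s * t + p * p * ∣ J ∣) ∣I∣≡K ⟩
      s * s * K + p * p * ∣ J ∣                      ≤⟨ +-monoʳ-≤ (s * s * K) p²∣J∣≤ ⟩
      s * s * K + 2 * R * (W * W)                    ∎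
      where
      open ≤-Reasoning
      ∣I∣≡K : ∣ I ∣ ≡ K
      ∣I∣≡K = trans (cong ∣_∣ X-form) (ℤP.∣-i∣≡∣i∣ (+ K))

    rest≤s³Z : rest ≤ s * s * s * Z
    rest≤s³Z = begin
      rest
        ≤⟨ +-mono-≤ (+-mono-≤ (*-mono-≤ (*-monoʳ-≤ 2 ∣G∣≤) u∣J∣≤) (*-mono-≤ u∣J∣≤ u∣J∣≤))
                    (*-mono-≤ (*-monoʳ-≤ (s * s) u∣b∣≤) ∣b∣≤) ⟩
      2 * (s * s * K + 2 * R * (W * W)) * (2 * (2 * R * (Y * W)))
        + (2 * (2 * R * (Y * W))) * (2 * (2 * R * (Y * W)))
        + s * s * (2 * (2 * R * (Y * W))) * (2 * R * (Y * Y))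
        ≡⟨ expand s K R Y ⟩
      s * s * s * (8 * V * (K + 2 * V) + 8 * (V * V)) + s * s * (16 * (V * V))
        ≤⟨ +-monoʳ-≤ (s * s * s * (8 * V * (K + 2 * V) + 8 * (V * V))) (*-monoˡ-≤ (16 * (V * V)) (m≤m*n (s * s) s)) ⟩
      s * s * s * (8 * V * (K + 2 * V) + 8 * (V * V)) + s * s * s * (16 * (V * V))
        ≡⟨ collect s K V ⟩
      s * s * s * Z
        ∎
      where
      open ≤-Reasoning
      expand : ∀ s K R Y →
        2 * (s * s * K + 2 * R * ((s * Y) * (s * Y))) * (2 * (2 * R * (Y * (s * Y))))
          + (2 * (2 * R * (Y * (s * Y)))) * (2 * (2 * R * (Y * (s * Y))))
          + s * s * (2 * (2 * R * (Y * (s * Y)))) * (2 * R * (Y * Y))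
        ≡ s * s * s * (8 * (R * (Y * Y)) * (K + 2 * (R * (Y * Y))) + 8 * ((R * (Y * Y)) * (R * (Y * Y))))
          + s * s * (16 * ((R * (Y * Y)) * (R * (Y * Y))))
      expand = ℕ-Ring.solve-∀
      collect : ∀ s K V → s * s * s * (8 * V * (K + 2 * V) + 8 * (V * V)) + s * s * s * (16 * (V * V))
                          ≡ s * s * s * (8 * V * (K + 5 * V))
      collect = ℕ-Ring.solve-∀

    2*rest<s⁴ : 2 * rest < s * s * s * s
    2*rest<s⁴ = begin-strict
      2 * rest               ≤⟨ *-monoʳ-≤ 2 rest≤s³Z ⟩
      2 * (s * s * s * Z)    ≡⟨ regroup (s * s * s) Z ⟩
      s * s * s * (2 * Z)    <⟨ *-monoʳ-< (s * s * s) (s≤s (m≤n+m (2 * Z) (c * X top))) ⟩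
      s * s * s * s          ∎
      where
      open ≤-Reasoning
      regroup : ∀ a z → 2 * (a * z) ≡ a * (2 * z)
      regroup = ℕ-Ring.solve-∀

    instance
      D≢0 : NonZero D
      D≢0 = m^n≢0 d h

    288[RY]²≤D² : 288 * ((R * Y) * (R * Y)) ≤ D * D
    288[RY]²≤D² = begin
      288 * ((R * Y) * (R * Y))        ≤⟨ *-monoˡ-≤ ((R * Y) * (R * Y)) (n≤1+n 288) ⟩
      289 * ((R * Y) * (R * Y))        ≡⟨ square-17 (R * Y) ⟩
      (17 * (R * Y)) * (17 * (R * Y))  ≤⟨ *-mono-≤ h-large h-large ⟩
      D * D                            ∎
      where
      open ≤-Reasoning
      square-17 : ∀ a → 289 * (a * a) ≡ (17 * a) * (17 * a)
      square-17 = ℕ-Ring.solve-∀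

    D²∣formE∣≤ : D * D * ∣ form (+ c) (+ E h) (+ E (suc h)) ∣ ≤ 2 * R * ((s + s + s) * (s + s + s))
    D²∣formE∣≤ = begin
      D * D * ∣ form (+ c) (+ E h) (+ E (suc h)) ∣                  ≤⟨ *-monoʳ-≤ (D * D) (∣form∣≤polar⁺ c (E h) (E (suc h))) ⟩
      D * D * polar⁺ c (E h) (E (suc h)) (E h) (E (suc h))          ≡⟨ polar⁺-scale c (E h) (E (suc h)) D ⟩
      polar⁺ c (D * E h) (D * E (suc h)) (D * E h) (D * E (suc h))  ≤⟨ polar⁺-bound c DEₕ≤ DEₕ₊₁≤ DEₕ≤ DEₕ₊₁≤ ⟩
      2 * R * ((s + s + s) * (s + s + s))                           ∎
      where
      open ≤-Reasoning
      DEₕ≤ : D * E h ≤ s + s + s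
      DEₕ≤ = proj₁ E-small
      DEₕ₊₁≤ : D * E (suc h) ≤ s + s + s
      DEₕ₊₁≤ = proj₂ E-small

    ∣formF∣≤ : ∣ form (+ c) (+ F 0) (+ F 1) ∣ ≤ 2 * R * ((W + W) * (W + W))
    ∣formF∣≤ = ≤-trans (∣form∣≤polar⁺ c (F 0) (F 1)) (polar⁺-bound c F₀≤ F₁≤ F₀≤ F₁≤)
      where
      F₀≤ : F 0 ≤ W + W
      F₀≤ = +-mono-≤ (*-monoʳ-≤ s X₀≤Y) pq₀≤W
      F₁≤ : F 1 ≤ W + W
      F₁≤ = +-monoʳ-≤ W pq₁≤W

    2*T₁≤s⁴ : 2 * T₁ ≤ s * s * s * s
    2*T₁≤s⁴ = *-cancelˡ-≤ (D * D) {{m*n≢0 D D}} (begin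
      D * D * (2 * T₁)                                    ≡⟨ regroup (D * D) _ _ ⟩
      2 * (D * D * ∣ form (+ c) (+ E h) (+ E (suc h)) ∣ * ∣ form (+ c) (+ F 0) (+ F 1) ∣)
        ≤⟨ *-monoʳ-≤ 2 (*-mono-≤ D²∣formE∣≤ ∣formF∣≤) ⟩
      2 * (2 * R * ((s + s + s) * (s + s + s)) * (2 * R * ((W + W) * (W + W))))
        ≡⟨ expand s R Y ⟩
      288 * ((R * Y) * (R * Y)) * (s * s * s * s)         ≤⟨ *-monoˡ-≤ (s * s * s * s) 288[RY]²≤D² ⟩
      D * D * (s * s * s * s)                             ∎)
      where
      open ≤-Reasoning
      regroup : ∀ x a b → x * (2 * (a * b)) ≡ 2 * (x * a * b)
      regroup = ℕ-Ring.solve-∀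
      expand : ∀ s R Y → 2 * (2 * R * ((s + s + s) * (s + s + s)) * (2 * R * ((s * Y + s * Y) * (s * Y + s * Y))))
                         ≡ 288 * ((R * Y) * (R * Y)) * (s * s * s * s)
      expand = ℕ-Ring.solve-∀

    ∣N∣≡0 : ∣ N ∣ ≡ 0
    ∣N∣≡0 = n<1⇒n≡0 (*-cancelˡ-< (s * s * s * s) ∣ N ∣ 1
      (subst (s * s * s * s * ∣ N ∣ <_) (sym (*-identityʳ (s * s * s * s)))
             (≤-half-sum {t = T₁} {rest} s⁴∣N∣≤T₁+rest 2*T₁≤s⁴ 2*rest<s⁴)))

    impossible : ⊥
    impossible = no-small-multiple {M} {K} J 0<K K<M
      (subst (λ i → i ℤ.+ + M ℤ.* J ≡ + 0) X-form (norm-zero {M} M-irrational (I ℤ.+ + M ℤ.* J) b ∣N∣≡0))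

-- The sequence x

-- The facts computing with the literal values are proved inside this abstract block, where arithmetic
-- on literals runs on builtins. Outside it d₀ is opaque, which keeps Agda from unfolding products
-- such as (1 + d₀) * 11427 * 2984191388685 by unary recursion.
abstract
  d₀ K₀ : ℕ
  d₀ = 261152655
  K₀ = 34100354867927166

  2≤d₀ : 2 ≤ d₀
  2≤d₀ = ≤ᵇ⇒≤ 2 d₀ tt

  instance
    d₀≢0 : NonZero d₀
    d₀≢0 = >-nonZero (≤-trans (s≤s z≤n) 2≤d₀)

  0<K₀ : 0 < K₀
  0<K₀ = z<s

  K₀<648560³ : K₀ < 648560 ^ 3
  K₀<648560³ = ≤ᵇ⇒≤ (suc K₀) (648560 ^ 3) tt

  -- 648560 is the least m with (2c + 1)² ≤ m³.
  [2c+1]²≤648560³ : (Lucas.c d₀ + Lucas.c d₀ + 1) * (Lucas.c d₀ + Lucas.c d₀ + 1) ≤ 648560 ^ 3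
  [2c+1]²≤648560³ = ≤ᵇ⇒≤ ((Lucas.c d₀ + Lucas.c d₀ + 1) * (Lucas.c d₀ + Lucas.c d₀ + 1)) (648560 ^ 3) tt

  y : ℕ → ℕ
  y zero = 11427
  y (suc zero) = 2984191388685
  y (suc (suc k)) = Lucas.c d₀ * y (suc k) ∸ y k

  y-ascending : ∀ k → y k ≤ y (suc k)
  y-ascending zero = ≤ᵇ⇒≤ 11427 2984191388685 tt
  y-ascending (suc k) = begin
    y (suc k)                             ≤⟨ m≤n*m (y (suc k)) d₀ ⟩
    d₀ * y (suc k)                        ≡⟨ sym (m+n∸m≡n (y (suc k)) (d₀ * y (suc k))) ⟩
    Lucas.c d₀ * y (suc k) ∸ y (suc k)    ≤⟨ ∸-monoʳ-≤ (Lucas.c d₀ * y (suc k)) (y-ascending k) ⟩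
    Lucas.c d₀ * y (suc k) ∸ y k          ∎
    where open ≤-Reasoning

  y-step : ∀ k → Step (Lucas.c d₀) y k
  y-step k = m∸n+n≡m (≤-trans (y-ascending k) (m≤n*m (y (suc k)) (Lucas.c d₀)))

  x≡y : ∀ k → x k ≡ + y k
  x≡y zero = refl
  x≡y (suc zero) = refl
  x≡y (suc (suc k)) = trans (cong₂ (λ a b → + 261152656 ℤ.* a ℤ.- b) (x≡y (suc k)) (x≡y k))
                            (sym (step-ℤ {Lucas.c d₀} {y} {k} (y-step k)))

  y-form : ∀ n → form (+ Lucas.c d₀) (+ y n) (+ y (suc n)) ≡ ℤ.- + K₀
  y-form n = form-conserved {Lucas.c d₀} y n (λ i _ → y-step i)

open Lucas d₀ using (c; module CloseWindow)

mainTheorem3 : (m : ℕ) → SquareFree m → 648560 ≤ m →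
    (N : ℕ) → Σ ℕ (λ k → N ≤ k × FracGt (x k) m)
mainTheorem3 m sf 648560≤m N = case anyUpTo? gap? (suc top) of λ where
      (yes (i , _ , gap)) → i + N , m≤n+m N i ,
        subst (λ z → FracGt z m) (sym (x≡y (i + N)))
              (fracGt-of-floor m (X i) (q i) (proj₂ (proj₂ (root (i + N)))) gap)
      (no no-gap) → ⊥-elim (CloseWindow.impossible M K₀ M-irrational 0<K₀ K₀<M
        (≤-trans [2c+1]²≤648560³ 648560³≤M) X q (λ i → y-step (i + N)) (λ i → y-ascending (i + N)) (y-form N)
        (λ i → proj₁ (proj₂ (root (i + N)))) h (<⇒≤ (n<m^n 2≤d₀ h))
        (λ i i≤top → ≮⇒≥ (λ gap → no-gap (i , s≤s i≤top , gap))))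
  where
  M : ℕ
  M = m ^ 3
  648560³≤M : 648560 ^ 3 ≤ M
  648560³≤M = ^-monoˡ-≤ 3 648560≤m
  K₀<M : K₀ < M
  K₀<M = <-≤-trans K₀<648560³ 648560³≤M
  instance
    M≢0 : NonZero M
    M≢0 = >-nonZero (≤-<-trans z≤n K₀<M)
  M-irrational : NotRatioOfSquares M
  M-irrational = cube-notRatioOfSquares {m} (squarefree⇒notRatioOfSquares sf (≤-trans (s≤s (s≤s z≤n)) 648560≤m))
  root : ∀ k → ∃[ q ] q * q * M ≤ y k * y k × y k * y k < suc q * suc q * M
  root k = floor-root M (y k * y k)
  X q : ℕ → ℕ
  X i = y (i + N)
  q i = proj₁ (root (i + N))
  h top : ℕ
  h = 17 * ((c + 2) * X 1)
  top = suc (h + h)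
  gap? : Decidable (λ i → q i * q i * M < (X i ∸ 2) * (X i ∸ 2))
  gap? i = q i * q i * M <? (X i ∸ 2) * (X i ∸ 2)
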